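{- There is a constant $c>0$ such that for all sufficiently large $n$ the following holds: if $\widetilde K_n$ is a convex straight-line drawing of $K_n$, then $\overline\tau(\widetilde K_n)\ge c\log\log n$, i.e. under every edge-ordering of $\widetilde K_n$ there is a non-crossing monotone complete binary tree in $\widetilde K_n$ with at least $c\log\log n$ vertices.
   Context: A geometric graph is a graph whose vertices are points in the plane in general position and whose edges are straight line segments; a straight-line drawing of $G$ is a geometric graph isomorphic to $G$; it is convex if its vertices are in convex position. An edge-ordering is a total order on the edges. In an edge-ordered graph, a path $v_1v_2\ldots v_k$ is increasing if $(v_iv_{i+1}) > (v_{i+1}v_{i+2})$ for all $i=1,\ldots,k-2$ and decreasing if $(v_iv_{i+1}) < (v_{i+1}v_{i+2})$ for all $i$. All binary trees are complete and rooted (every internal vertex has exactly two children and all leaves are at the same depth); the size of a tree is its number of vertices. A rooted tree (as a subgraph) is increasing (resp. decreasing) if every path from the root to a leaf is increasing (resp. decreasing), and monotone if it is increasing or decreasing. A tree in a geometric graph is non-crossing if no two of its edges cross. $\overline\tau(\widetilde G)$ is the minimum over all edge-orderings of $\widetilde G$ of the maximum size of a non-crossing monotone binary tree in $\widetilde G$. -}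

module Defs where

open import Data.Nat using (ℕ; zero; suc; _+_; _*_; _^_; _<_; _≤_)
open import Data.Fin using (Fin; toℕ)
open import Data.List using (List; []; _∷_; _++_; map; concatMap; length)
open import Data.List.Relation.Unary.All using (All)
open import Data.List.Relation.Unary.Unique.Propositional using (Unique)
open import Data.List.Membership.Propositional using (_∈_)
open import Data.Product using (_×_; _,_; Σ)
open import Data.Sum using (_⊎_)
open import Data.Unit using (⊤)
open import Relation.Binary.PropositionalEquality using (_≡_; _≢_)
open import Relation.Nullary using (¬_)

-- Convex drawing of K_n: the n vertices are points in convex position,
-- labelled 0,…,n-1 in cyclic order around the convex hull.  Whether two
-- edges cross depends only on this cyclic order: two edges cross iff
-- their four endpoints are distinct and strictly interleave.

Interleave : ℕ → ℕ → ℕ → ℕ → Set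
Interleave a b c d = a < c × c < b × b < d

Crosses : ∀ {n} → Fin n → Fin n → Fin n → Fin n → Set
Crosses x y u w =
  let a = toℕ x ; b = toℕ y ; c = toℕ u ; d = toℕ w in
  (Interleave a b c d ⊎ Interleave b a c d) ⊎ (Interleave a b d c ⊎ Interleave b a d c)
  ⊎ ((Interleave c d a b ⊎ Interleave d c a b) ⊎ (Interleave c d b a ⊎ Interleave d c b a))

-- An edge-ordering of K_n: a total order on the edges, given by an
-- injective rank function on unordered pairs of distinct vertices.
record EdgeOrdering (n : ℕ) : Set where
  field
    rank      : Fin n → Fin n → ℕ
    symmetric : ∀ x y → rank x y ≡ rank y x
    injective : ∀ x y u w → x ≢ y → u ≢ w → rank x y ≡ rank u w →
                (x ≡ u × y ≡ w) ⊎ (x ≡ w × y ≡ u)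
open EdgeOrdering public

data BTree (n : ℕ) : ℕ → Set where
  leaf : Fin n → BTree n zero
  node : ∀ {d} → Fin n → BTree n d → BTree n d → BTree n (suc d)

root : ∀ {n d} → BTree n d → Fin n
root (leaf v)     = v
root (node v _ _) = v

vertices : ∀ {n d} → BTree n d → List (Fin n)
vertices (leaf v)     = v ∷ []
vertices (node v l r) = v ∷ (vertices l ++ vertices r)

size : ∀ {n d} → BTree n d → ℕ
size t = length (vertices t)

edges : ∀ {n d} → BTree n d → List (Fin n × Fin n)
edges (leaf v)     = []
edges (node v l r) = (v , root l) ∷ (v , root r) ∷ (edges l ++ edges r)

paths : ∀ {n d} → BTree n d → List (List (Fin n))
paths (leaf v)     = (v ∷ []) ∷ []
paths (node v l r) = map (v ∷_) (paths l ++ paths r)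

-- A tree in K_n: its vertices are pairwise distinct (K_n is complete, so
-- every parent-child pair is then an edge of K_n).
IsSubtree : ∀ {n d} → BTree n d → Set
IsSubtree t = Unique (vertices t)

NonCrossing : ∀ {n d} → BTree n d → Set
NonCrossing t = ∀ {e f} → e ∈ edges t → f ∈ edges t →
  ¬ Crosses (Data.Product.proj₁ e) (Data.Product.proj₂ e)
            (Data.Product.proj₁ f) (Data.Product.proj₂ f)

IncreasingPath : ∀ {n} → EdgeOrdering n → List (Fin n) → Set
IncreasingPath o (x ∷ y ∷ z ∷ rest) =
  rank o y z < rank o x y × IncreasingPath o (y ∷ z ∷ rest)
IncreasingPath o _ = ⊤

DecreasingPath : ∀ {n} → EdgeOrdering n → List (Fin n) → Set
DecreasingPath o (x ∷ y ∷ z ∷ rest) =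
  rank o x y < rank o y z × DecreasingPath o (y ∷ z ∷ rest)
DecreasingPath o _ = ⊤

Monotone : ∀ {n d} → EdgeOrdering n → BTree n d → Set
Monotone o t = All (IncreasingPath o) (paths t) ⊎ All (DecreasingPath o) (paths t)

HasNCMonotoneTree : ∀ {n} → EdgeOrdering n → ℕ → Set
HasNCMonotoneTree {n} o s =
  Σ ℕ λ d → Σ (BTree n d) λ t →
    IsSubtree t × NonCrossing t × Monotone o t × size t ≡ s

{-# OPTIONS --safe #-}
-- Label the vertices 0, …, n-1 in cyclic order. A binary tree whose preorder vertex list is
-- increasing is non-crossing, since any two of its edges span disjoint or nested intervals.
-- Colour each triple x < y < z by whether the path x y z is increasing. A greedy
-- Erdős–Rado argument extracts from the n vertices a sequence of length t ≈ √(log n) on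
-- which the colour of x < y < z depends only on x and y. On it, a Ramsey-type recursion
-- (root = first vertex; one colour class of its edges to later vertices is large enough to be
-- split into two halves; recurse in both) yields such a sorted tree of depth d ≈ (log t) / 6
-- with all edges of one colour, which makes every root-to-leaf path monotone. Its size is
-- at least d + 1 ≥ (log log n) / 12.
module Submission where

open import Defs
open import Data.Nat using (ℕ; zero; suc; _+_; _*_; _^_; _≤_; _<_; z≤n; s≤s; _<ᵇ_)
open import Data.Nat.Properties
open import Data.Nat.Tactic.RingSolver using (solve-∀)
open import Data.Bool using (Bool; true; false; T)
import Data.Bool.Properties as Bool
open import Data.Unit using (tt)
open import Data.Empty using (⊥-elim)
open import Data.Fin as Fin using (Fin; toℕ)
import Data.Fin.Properties as Finₚ
open import Data.List using (List; []; _∷_; _++_; length; filter; take; drop; allFin)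
open import Data.List.Properties using (length-++; length-take; length-drop; take++drop≡id; length-tabulate)
open import Data.List.Membership.Propositional using (_∈_)
open import Data.List.Membership.Propositional.Properties using (∈-++⁺ˡ; ∈-++⁺ʳ; ∈-++⁻)
open import Data.List.Relation.Unary.Any using (here; there)
open import Data.List.Relation.Unary.All as All using (All; []; _∷_)
import Data.List.Relation.Unary.All.Properties as Allₚ
open import Data.List.Relation.Unary.AllPairs as AllPairs using (AllPairs; []; _∷_)
import Data.List.Relation.Unary.AllPairs.Properties as AllPairsₚ
open import Data.List.Relation.Unary.Linked as Linked using (Linked; []; [-]; _∷_)
open import Data.List.Relation.Binary.Sublist.Propositional
  using (_⊆_; []; _∷_; _∷ʳ_; ⊆-refl; ⊆-trans; ⊆-reflexive; minimum)
open import Data.List.Relation.Binary.Sublist.Propositional.Properties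
  using (filter-⊆; take-⊆; drop-⊆; ++⁺; All-resp-⊆; Any-resp-⊆)
open import Data.List.Extrema.Nat using (argmax; argmax-sel; f[⊥]≤f[argmax]; f[xs]≤f[argmax])
open import Data.Product as Product using (Σ; Σ-syntax; ∃-syntax; _×_; _,_; proj₁; proj₂)
open import Data.Sum as Sum using (_⊎_; inj₁; inj₂; [_,_]; [_,_]′)
open import Relation.Binary.PropositionalEquality using (_≡_; _≢_; refl; sym; trans; cong; subst)
open import Relation.Nullary using (¬_; yes; no)
open import Function using (_∘_)

-- Each of the m points already chosen halves the pool of candidates for the next point.
endHomSize : ℕ → ℕ → ℕ
endHomSize m zero    = zero
endHomSize m (suc t) = suc (2 ^ m * endHomSize (suc m) t)

-- A root plus two halves of one colour class of the remaining vertices.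
treeRamsey : ℕ → ℕ → ℕ
treeRamsey zero    b       = 1
treeRamsey (suc a) zero    = 1
treeRamsey (suc a) (suc b) = suc (2 * treeRamsey a (suc b) + 2 * treeRamsey (suc a) b)

1≤2^ : ∀ e → 1 ≤ 2 ^ e
1≤2^ = m^n>0 2

n≤2^n : ∀ n → n ≤ 2 ^ n
n≤2^n zero    = z≤n
n≤2^n (suc n) = +-mono-≤ (1≤2^ n) (≤-trans (n≤2^n n) (m≤m+n _ 0))

1+n≤2*n : ∀ {n} → 1 ≤ n → suc n ≤ 2 * n
1+n≤2*n {n} 1≤n = +-mono-≤ 1≤n (m≤m+n n 0)

endHomSize-≤ : ∀ m t → endHomSize m t ≤ 2 ^ (m * t + t * t)
endHomSize-≤ m zero    = z≤n
endHomSize-≤ m (suc t) = begin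
  suc (2 ^ m * endHomSize (suc m) t)      ≤⟨ s≤s (*-monoʳ-≤ (2 ^ m) (endHomSize-≤ (suc m) t)) ⟩
  suc (2 ^ m * 2 ^ (suc m * t + t * t))   ≡⟨ cong suc (sym (^-distribˡ-+-* 2 m _)) ⟩
  suc (2 ^ e)                             ≤⟨ 1+n≤2*n (1≤2^ e) ⟩
  2 ^ suc e                               ≤⟨ ^-monoʳ-≤ 2 (m≤m+n (suc e) t) ⟩
  2 ^ (suc e + t)                         ≡⟨ cong (2 ^_) (exponent m t) ⟩
  2 ^ (m * suc t + suc t * suc t)         ∎
  where
    open ≤-Reasoning
    e = m + (suc m * t + t * t)
    exponent : ∀ m t → suc (m + (suc m * t + t * t)) + t ≡ m * suc t + suc t * suc t
    exponent = solve-∀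

treeRamsey-≤ : ∀ a b → treeRamsey a b ≤ 2 ^ (3 * (a + b))
treeRamsey-≤ zero    b       = 1≤2^ (3 * b)
treeRamsey-≤ (suc a) zero    = 1≤2^ (3 * (suc a + 0))
treeRamsey-≤ (suc a) (suc b) = begin
  suc (2 * treeRamsey a (suc b) + 2 * treeRamsey (suc a) b)
    ≤⟨ s≤s (+-mono-≤ (*-monoʳ-≤ 2 (treeRamsey-≤ a (suc b)))
                     (*-monoʳ-≤ 2 (treeRamsey-≤ (suc a) b))) ⟩
  suc (2 * 2 ^ (3 * (a + suc b)) + 2 * p)
    ≡⟨ cong (λ k → suc (2 * 2 ^ (3 * k) + 2 * p)) (+-suc a b) ⟩
  suc (2 * p + 2 * p)
    ≤⟨ 1+n≤2*n (≤-trans (1≤2^ (3 * (suc a + b)))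
                        (≤-trans (m≤m+n p (1 * p)) (m≤m+n (2 * p) (2 * p)))) ⟩
  2 * (2 * p + 2 * p)
    ≡⟨ eight p ⟩
  2 ^ 3 * p
    ≡⟨ sym (^-distribˡ-+-* 2 3 (3 * (suc a + b))) ⟩
  2 ^ (3 + 3 * (suc a + b))
    ≡⟨ cong (2 ^_) (exponent a b) ⟩
  2 ^ (3 * (suc a + suc b)) ∎
  where
    open ≤-Reasoning
    p = 2 ^ (3 * (suc a + b))
    eight : ∀ p → 2 * (2 * p + 2 * p) ≡ 2 ^ 3 * p
    eight = solve-∀
    exponent : ∀ a b → 3 + 3 * (suc a + b) ≡ 3 * (suc a + suc b)
    exponent = solve-∀

threshold : ℕ → ℕ
threshold d = endHomSize 0 (treeRamsey d d)

threshold-≤ : ∀ d → threshold d ≤ 2 ^ (2 ^ (12 * d))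
threshold-≤ d = begin
  endHomSize 0 t  ≤⟨ endHomSize-≤ 0 t ⟩
  2 ^ (t * t)     ≤⟨ ^-monoʳ-≤ 2 (*-mono-≤ (treeRamsey-≤ d d) (treeRamsey-≤ d d)) ⟩
  2 ^ (2 ^ e * 2 ^ e)  ≡⟨ cong (2 ^_) (sym (^-distribˡ-+-* 2 e e)) ⟩
  2 ^ (2 ^ (e + e))    ≡⟨ cong (λ k → 2 ^ (2 ^ k)) (twelve d) ⟩
  2 ^ (2 ^ (12 * d)) ∎
  where
    open ≤-Reasoning
    t = treeRamsey d d
    e = 3 * (d + d)
    twelve : ∀ d → 3 * (d + d) + 3 * (d + d) ≡ 12 * d
    twelve = solve-∀

bracket : (T U : ℕ → ℕ) → (∀ d → T (suc d) ≤ U d) →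
          ∀ {n} m → T 0 ≤ n → n ≤ U m → ∃[ d ] T d ≤ n × n ≤ U d
bracket T U T≤U zero    T0≤n n≤U0 = 0 , T0≤n , n≤U0
bracket T U T≤U {n} (suc m) T0≤n n≤U with n ≤? U m
... | yes n≤Um = bracket T U T≤U m T0≤n n≤Um
... | no  n≰Um = suc m , ≤-trans (T≤U m) (<⇒≤ (≰⇒> n≰Um)) , n≤U

≤-split : ∀ a b c d → a + b ≤ c + d → a ≤ c ⊎ b ≤ d
≤-split a b c d a+b≤c+d with a ≤? c
... | yes a≤c = inj₁ a≤c
... | no  a≰c = inj₂ (+-cancelˡ-≤ c b d (≤-trans (+-monoˡ-≤ b (<⇒≤ (≰⇒> a≰c))) a+b≤c+d))

m+n≤2*n : ∀ {m n} → m ≤ n → m + n ≤ 2 * n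
m+n≤2*n {m} {n} m≤n = subst (m + n ≤_) (cong (n +_) (sym (+-identityʳ n))) (+-monoˡ-≤ n m≤n)

module _ {A : Set} where

  class : (A → Bool) → Bool → List A → List A
  class f b = filter (λ x → f x Bool.≟ b)

  class-⊆ : ∀ f b xs → class f b xs ⊆ xs
  class-⊆ f b = filter-⊆ (λ x → f x Bool.≟ b)

  class-coloured : ∀ f b xs → All (λ x → f x ≡ b) (class f b xs)
  class-coloured f b = Allₚ.all-filter (λ x → f x Bool.≟ b)

  length-classes : ∀ f xs → length (class f false xs) + length (class f true xs) ≡ length xs
  length-classes f []       = refl
  length-classes f (x ∷ xs) with f x
  ... | false = cong suc (length-classes f xs)
  ... | true  = trans (+-suc _ _) (cong suc (length-classes f xs))

  Monochromatic : (A → Bool) → List A → Set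
  Monochromatic f xs = ∃[ b ] All (λ x → f x ≡ b) xs

  monochromatic-⊆ : ∀ {f xs ys} → xs ⊆ ys → Monochromatic f ys → Monochromatic f xs
  monochromatic-⊆ xs⊆ys = Product.map₂ (All-resp-⊆ xs⊆ys)

  majority-sublist : ∀ f xs → ∃[ ys ] ys ⊆ xs × Monochromatic f ys × length xs ≤ 2 * length ys
  majority-sublist f xs with length (class f false xs) ≤? length (class f true xs)
  ... | yes F≤T = class f true xs , class-⊆ f true xs , (true , class-coloured f true xs) ,
                  subst (_≤ 2 * length (class f true xs)) (length-classes f xs) (m+n≤2*n F≤T)
  ... | no  F≰T = class f false xs , class-⊆ f false xs , (false , class-coloured f false xs) ,
                  subst (_≤ 2 * length (class f false xs))
                        (trans (+-comm (length (class f true xs)) _) (length-classes f xs))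
                        (m+n≤2*n (<⇒≤ (≰⇒> F≰T)))

  monochromatic-sublist : ∀ {I : Set} (g : I → A → Bool) (qs : List I) xs →
    ∃[ ys ] ys ⊆ xs × All (λ q → Monochromatic (g q) ys) qs × length xs ≤ 2 ^ length qs * length ys
  monochromatic-sublist g []       xs = xs , ⊆-refl , [] , m≤m+n (length xs) 0
  monochromatic-sublist g (q ∷ qs) xs with majority-sublist (g q) xs
  ... | ys , ys⊆ , mono , |xs|≤ with monochromatic-sublist g qs ys
  ...   | zs , zs⊆ , monos , |ys|≤ =
    zs , ⊆-trans zs⊆ ys⊆ , monochromatic-⊆ zs⊆ mono ∷ monos , (begin
      length xs                              ≤⟨ |xs|≤ ⟩
      2 * length ys                          ≤⟨ *-monoʳ-≤ 2 |ys|≤ ⟩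
      2 * (2 ^ length qs * length zs)        ≡⟨ sym (*-assoc 2 (2 ^ length qs) _) ⟩
      2 ^ length (q ∷ qs) * length zs        ∎)
    where open ≤-Reasoning

  halves : ∀ m (xs : List A) → 2 * m ≤ length xs → m ≤ length (take m xs) × m ≤ length (drop m xs)
  halves m xs 2m≤ = subst (m ≤_) (sym (length-take m xs)) (≤-reflexive (sym (m≤n⇒m⊓n≡m m≤)))
                  , subst (m ≤_) (sym (length-drop m xs)) (m+n≤o⇒m≤o∸n m m+m≤)
    where
      m+m≤ : m + m ≤ length xs
      m+m≤ = subst (_≤ length xs) (cong (m +_) (+-identityʳ m)) 2m≤
      m≤ : m ≤ length xs
      m≤ = ≤-trans (m≤m+n m m) m+m≤

  AllPairs-⊆ : ∀ {R : A → A → Set} {xs ys} → xs ⊆ ys → AllPairs R ys → AllPairs R xs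
  AllPairs-⊆ []           []         = []
  AllPairs-⊆ (y ∷ʳ xs⊆)   (_ ∷ rys)   = AllPairs-⊆ xs⊆ rys
  AllPairs-⊆ (refl ∷ xs⊆) (ry ∷ rys) = All-resp-⊆ xs⊆ ry ∷ AllPairs-⊆ xs⊆ rys

  AllPairs-++⁻ : ∀ {R : A → A → Set} xs {ys} → AllPairs R (xs ++ ys) →
                 AllPairs R xs × AllPairs R ys × All (λ x → All (R x) ys) xs
  AllPairs-++⁻ []       rys = [] , rys , []
  AllPairs-++⁻ (x ∷ xs) (rx ∷ rxs) with AllPairs-++⁻ xs rxs
  ... | rxs′ , rys , rxys = Allₚ.++⁻ˡ xs rx ∷ rxs′ , rys , Allₚ.++⁻ʳ xs rx ∷ rxys

∈-tail : ∀ {n} {x z : Fin n} {xs} → z ∈ x ∷ xs → x Fin.< z → z ∈ xs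
∈-tail (here refl) x<x = ⊥-elim (<-irrefl refl x<x)
∈-tail (there z∈)  _   = z∈

allFin-sorted : ∀ n → AllPairs Fin._<_ (allFin n)
allFin-sorted n = AllPairsₚ.tabulate⁺-< (λ i<j → i<j)

length-allFin : ∀ n → length (allFin n) ≡ n
length-allFin n = length-tabulate (λ i → i)

module _ {n : ℕ} where

  data Laminar : Fin n × Fin n → Fin n × Fin n → Set where
    before   : ∀ {a b c d} → b Fin.≤ c → Laminar (a , b) (c , d)
    after    : ∀ {a b c d} → d Fin.≤ a → Laminar (a , b) (c , d)
    inside   : ∀ {a b c d} → c Fin.≤ a → b Fin.≤ d → Laminar (a , b) (c , d)
    contains : ∀ {a b c d} → a Fin.≤ c → d Fin.≤ b → Laminar (a , b) (c , d)

  laminar-sym : ∀ {e f} → Laminar e f → Laminar f e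
  laminar-sym (before b≤c)       = after b≤c
  laminar-sym (after d≤a)        = before d≤a
  laminar-sym (inside c≤a b≤d)   = contains c≤a b≤d
  laminar-sym (contains a≤c d≤b) = inside a≤c d≤b

  interleaved⇒¬laminar : ∀ {a b c d : Fin n} → Interleave (toℕ a) (toℕ b) (toℕ c) (toℕ d) →
                         ¬ Laminar (a , b) (c , d)
  interleaved⇒¬laminar (a<c , c<b , b<d) (before b≤c)     = <⇒≱ c<b b≤c
  interleaved⇒¬laminar (a<c , c<b , b<d) (after d≤a)      = <⇒≱ (<-trans a<c (<-trans c<b b<d)) d≤a
  interleaved⇒¬laminar (a<c , c<b , b<d) (inside c≤a _)   = <⇒≱ a<c c≤a
  interleaved⇒¬laminar (a<c , c<b , b<d) (contains _ d≤b) = <⇒≱ b<d d≤b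

  -- With both chords oriented upwards only two of the eight disjuncts of Crosses are consistent.
  laminar⇒¬crossing : ∀ {a b c d : Fin n} → a Fin.< b → c Fin.< d →
                      Laminar (a , b) (c , d) → ¬ Crosses a b c d
  laminar⇒¬crossing a<b c<d l (inj₁ (inj₁ abcd))                        = interleaved⇒¬laminar abcd l
  laminar⇒¬crossing a<b c<d l (inj₁ (inj₂ (b<c , c<a , _)))             = <-asym a<b (<-trans b<c c<a)
  laminar⇒¬crossing a<b c<d l (inj₂ (inj₁ (inj₁ (_ , d<b , b<c))))      = <-asym c<d (<-trans d<b b<c)
  laminar⇒¬crossing a<b c<d l (inj₂ (inj₁ (inj₂ (b<d , d<a , _))))      = <-asym a<b (<-trans b<d d<a)
  laminar⇒¬crossing a<b c<d l (inj₂ (inj₂ (inj₁ (inj₁ cdab))))          =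
    interleaved⇒¬laminar cdab (laminar-sym l)
  laminar⇒¬crossing a<b c<d l (inj₂ (inj₂ (inj₁ (inj₂ (d<a , a<c , _))))) = <-asym c<d (<-trans d<a a<c)
  laminar⇒¬crossing a<b c<d l (inj₂ (inj₂ (inj₂ (inj₁ (_ , b<d , d<a))))) = <-asym a<b (<-trans b<d d<a)
  laminar⇒¬crossing a<b c<d l (inj₂ (inj₂ (inj₂ (inj₂ (d<b , b<c , _))))) = <-asym c<d (<-trans d<b b<c)

  Sorted : ∀ {d} → BTree n d → Set
  Sorted t = AllPairs Fin._<_ (vertices t)

  root-∈ : ∀ {d} (t : BTree n d) → root t ∈ vertices t
  root-∈ (leaf v)     = here refl
  root-∈ (node v l r) = here refl

  root-≤ : ∀ {d} (t : BTree n d) → Sorted t → ∀ {x} → x ∈ vertices t → root t Fin.≤ x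
  root-≤ (leaf v)     _        (here refl) = ≤-refl
  root-≤ (node v l r) _        (here refl) = ≤-refl
  root-≤ (node v l r) (v< ∷ _) (there x∈)  = <⇒≤ (All.lookup v< x∈)

  record SortedNode {d} (v : Fin n) (l r : BTree n d) : Set where
    field
      root<left  : ∀ {x} → x ∈ vertices l → v Fin.< x
      root<right : ∀ {x} → x ∈ vertices r → v Fin.< x
      left<right : ∀ {x y} → x ∈ vertices l → y ∈ vertices r → x Fin.< y
      sorted-left  : Sorted l
      sorted-right : Sorted r

  sorted-node : ∀ {d v} (l r : BTree n d) → Sorted (node v l r) → SortedNode v l r
  sorted-node l r (v< ∷ s) with AllPairs-++⁻ (vertices l) s
  ... | sl , sr , l<r = record
    { root<left    = λ x∈ → All.lookup v< (∈-++⁺ˡ x∈)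
    ; root<right   = λ x∈ → All.lookup v< (∈-++⁺ʳ (vertices l) x∈)
    ; left<right   = λ x∈ y∈ → All.lookup (All.lookup l<r x∈) y∈
    ; sorted-left  = sl
    ; sorted-right = sr
    }

  data NodeEdge {d} (v : Fin n) (l r : BTree n d) : Fin n × Fin n → Set where
    left-root  : NodeEdge v l r (v , root l)
    right-root : NodeEdge v l r (v , root r)
    in-left    : ∀ {e} → e ∈ edges l → NodeEdge v l r e
    in-right   : ∀ {e} → e ∈ edges r → NodeEdge v l r e

  node-edge : ∀ {d v} (l r : BTree n d) {e} → e ∈ edges (node v l r) → NodeEdge v l r e
  node-edge l r (here refl)         = left-root
  node-edge l r (there (here refl)) = right-root
  node-edge l r (there (there e∈))  = [ in-left , in-right ] (∈-++⁻ (edges l) e∈)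

  edge-endpoints : ∀ {d} (t : BTree n d) {e} → e ∈ edges t →
                   proj₁ e ∈ vertices t × proj₂ e ∈ vertices t
  edge-endpoints (node v l r) e∈ with node-edge l r e∈
  ... | left-root     = here refl , there (∈-++⁺ˡ (root-∈ l))
  ... | right-root    = here refl , there (∈-++⁺ʳ (vertices l) (root-∈ r))
  ... | in-left  e∈l  = Product.map (there ∘ ∈-++⁺ˡ) (there ∘ ∈-++⁺ˡ) (edge-endpoints l e∈l)
  ... | in-right e∈r  = Product.map (there ∘ ∈-++⁺ʳ (vertices l)) (there ∘ ∈-++⁺ʳ (vertices l))
                                    (edge-endpoints r e∈r)

  sorted⇒edge-< : ∀ {d} (t : BTree n d) → Sorted t →
                  ∀ {e} → e ∈ edges t → proj₁ e Fin.< proj₂ e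
  sorted⇒edge-< (node v l r) s e∈ with node-edge l r e∈
  ... | left-root    = root<left (root-∈ l)   where open SortedNode (sorted-node l r s)
  ... | right-root   = root<right (root-∈ r)  where open SortedNode (sorted-node l r s)
  ... | in-left  e∈l = sorted⇒edge-< l (SortedNode.sorted-left (sorted-node l r s)) e∈l
  ... | in-right e∈r = sorted⇒edge-< r (SortedNode.sorted-right (sorted-node l r s)) e∈r

  sorted⇒laminar : ∀ {d} (t : BTree n d) → Sorted t →
                   ∀ {e f} → e ∈ edges t → f ∈ edges t → Laminar e f
  sorted⇒laminar (node v l r) s e∈ f∈ = laminar (node-edge l r e∈) (node-edge l r f∈)
    where
      open SortedNode (sorted-node l r s)
      ends-l = edge-endpoints l
      ends-r = edge-endpoints r
      roots : Laminar (v , root l) (v , root r)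
      roots = inside ≤-refl (<⇒≤ (left<right (root-∈ l) (root-∈ r)))
      left-root-left : ∀ {f} → f ∈ edges l → Laminar (v , root l) f
      left-root-left f∈ = before (root-≤ l sorted-left (proj₁ (ends-l f∈)))
      left-root-right : ∀ {f} → f ∈ edges r → Laminar (v , root l) f
      left-root-right f∈ = before (<⇒≤ (left<right (root-∈ l) (proj₁ (ends-r f∈))))
      right-root-left : ∀ {f} → f ∈ edges l → Laminar (v , root r) f
      right-root-left f∈ =
        contains (<⇒≤ (root<left (proj₁ (ends-l f∈))))
                 (<⇒≤ (left<right (proj₂ (ends-l f∈)) (root-∈ r)))
      right-root-right : ∀ {f} → f ∈ edges r → Laminar (v , root r) f
      right-root-right f∈ = before (root-≤ r sorted-right (proj₁ (ends-r f∈)))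
      left-right : ∀ {e f} → e ∈ edges l → f ∈ edges r → Laminar e f
      left-right e∈ f∈ = before (<⇒≤ (left<right (proj₂ (ends-l e∈)) (proj₁ (ends-r f∈))))
      laminar : ∀ {e f} → NodeEdge v l r e → NodeEdge v l r f → Laminar e f
      laminar left-root     left-root     = inside ≤-refl ≤-refl
      laminar left-root     right-root    = roots
      laminar left-root     (in-left  f∈) = left-root-left f∈
      laminar left-root     (in-right f∈) = left-root-right f∈
      laminar right-root    left-root     = laminar-sym roots
      laminar right-root    right-root    = inside ≤-refl ≤-refl
      laminar right-root    (in-left  f∈) = right-root-left f∈
      laminar right-root    (in-right f∈) = right-root-right f∈
      laminar (in-left  e∈) left-root     = laminar-sym (left-root-left e∈)
      laminar (in-left  e∈) right-root    = laminar-sym (right-root-left e∈)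
      laminar (in-left  e∈) (in-left  f∈) = sorted⇒laminar l sorted-left e∈ f∈
      laminar (in-left  e∈) (in-right f∈) = left-right e∈ f∈
      laminar (in-right e∈) left-root     = laminar-sym (left-root-right e∈)
      laminar (in-right e∈) right-root    = laminar-sym (right-root-right e∈)
      laminar (in-right e∈) (in-left  f∈) = laminar-sym (left-right f∈ e∈)
      laminar (in-right e∈) (in-right f∈) = sorted⇒laminar r sorted-right e∈ f∈

  sorted⇒nonCrossing : ∀ {d} (t : BTree n d) → Sorted t → NonCrossing t
  sorted⇒nonCrossing t s e∈ f∈ =
    laminar⇒¬crossing (sorted⇒edge-< t s e∈) (sorted⇒edge-< t s f∈) (sorted⇒laminar t s e∈ f∈)

  sorted⇒subtree : ∀ {d} (t : BTree n d) → Sorted t → IsSubtree t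
  sorted⇒subtree t = AllPairs.map Finₚ.<⇒≢

  1+depth≤size : ∀ {d} (t : BTree n d) → suc d ≤ size t
  1+depth≤size (leaf v)     = s≤s z≤n
  1+depth≤size (node v l r) = s≤s (≤-trans (1+depth≤size l)
    (subst (size l ≤_) (sym (length-++ (vertices l))) (m≤m+n (size l) (size r))))

  EdgeOf : ∀ {d} → BTree n d → Fin n → Fin n → Set
  EdgeOf t x y = (x , y) ∈ edges t

  paths-head : ∀ {d} (t : BTree n d) → All (λ p → ∃[ q ] p ≡ root t ∷ q) (paths t)
  paths-head (leaf v)     = ([] , refl) ∷ []
  paths-head (node v l r) = Allₚ.map⁺ (All.universal (λ p → p , refl) (paths l ++ paths r))

  paths-linked : ∀ {d} (t : BTree n d) → All (Linked (EdgeOf t)) (paths t)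
  paths-linked (leaf v)     = [-] ∷ []
  paths-linked (node v l r) = Allₚ.map⁺ (Allₚ.++⁺
    (through l (here refl)
      (All.map (Linked.map (there ∘ there ∘ ∈-++⁺ˡ)) (paths-linked l)))
    (through r (there (here refl))
      (All.map (Linked.map (there ∘ there ∘ ∈-++⁺ʳ (edges l))) (paths-linked r))))
    where
      through : ∀ {d} (s : BTree n d) → EdgeOf (node v l r) v (root s) →
                All (Linked (EdgeOf (node v l r))) (paths s) →
                All (λ p → Linked (EdgeOf (node v l r)) (v ∷ p)) (paths s)
      through s v→s linked = All.zipWith (λ { ((q , refl) , lp) → v→s ∷ lp }) (paths-head s , linked)

module TreeRamsey {n : ℕ} (c : Fin n → Fin n → Bool) where

  Coloured : ∀ {d} → Bool → BTree n d → Set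
  Coloured b t = All (λ e → c (proj₁ e) (proj₂ e) ≡ b) (edges t)

  ColouredTree : Bool → ℕ → List (Fin n) → Set
  ColouredTree b d L = Σ[ t ∈ BTree n d ] vertices t ⊆ L × Coloured b t

  weaken : ∀ {b d L L′} → L ⊆ L′ → ColouredTree b d L → ColouredTree b d L′
  weaken L⊆L′ (t , t⊆L , col) = t , ⊆-trans t⊆L L⊆L′ , col

  singleton : ∀ {b x xs} → ColouredTree b 0 (x ∷ xs)
  singleton {xs = xs} = leaf _ , refl ∷ minimum xs , []

  join : ∀ {b d y rest} (P Q : List (Fin n)) → P ++ Q ⊆ class (c y) b rest →
         ColouredTree b d P → ColouredTree b d Q → ColouredTree b (suc d) (y ∷ rest)
  join {b} {y = y} {rest} P Q PQ⊆ (t₁ , t₁⊆P , col₁) (t₂ , t₂⊆Q , col₂) =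
    node y t₁ t₂ , refl ∷ ⊆-trans vs⊆ (class-⊆ (c y) b rest) ,
    All.lookup y→vs (∈-++⁺ˡ (root-∈ t₁)) ∷
    All.lookup y→vs (∈-++⁺ʳ (vertices t₁) (root-∈ t₂)) ∷
    Allₚ.++⁺ col₁ col₂
    where
      vs⊆ : vertices t₁ ++ vertices t₂ ⊆ class (c y) b rest
      vs⊆ = ⊆-trans (++⁺ t₁⊆P t₂⊆Q) PQ⊆
      y→vs : All (λ x → c y x ≡ b) (vertices t₁ ++ vertices t₂)
      y→vs = All-resp-⊆ vs⊆ (class-coloured (c y) b rest)

  grow : ∀ {O : Set} b {d m y rest} →
         (∀ P → P ⊆ y ∷ rest → m ≤ length P → ColouredTree b d P ⊎ O) →
         2 * m ≤ length (class (c y) b rest) → ColouredTree b (suc d) (y ∷ rest) ⊎ O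
  grow {O} b {d} {m} {y} {rest} tree-in 2m≤ =
    combine (tree-in (take m C) (y ∷ʳ ⊆-trans (take-⊆ m C) C⊆rest) (proj₁ (halves m C 2m≤)))
            (tree-in (drop m C) (y ∷ʳ ⊆-trans (drop-⊆ m C) C⊆rest) (proj₂ (halves m C 2m≤)))
    where
      C = class (c y) b rest
      C⊆rest = class-⊆ (c y) b rest
      combine : ColouredTree b d (take m C) ⊎ O → ColouredTree b d (drop m C) ⊎ O →
                ColouredTree b (suc d) (y ∷ rest) ⊎ O
      combine (inj₁ t₁) (inj₁ t₂) =
        inj₁ (join (take m C) (drop m C) (⊆-reflexive (take++drop≡id m C)) t₁ t₂)
      combine (inj₂ o)  _         = inj₂ o
      combine (inj₁ _)  (inj₂ o)  = inj₂ o

  coloured-tree : ∀ a b L → treeRamsey a b ≤ length L → ColouredTree false a L ⊎ ColouredTree true b L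
  coloured-tree zero    b       (x ∷ xs) _ = inj₁ singleton
  coloured-tree (suc a) zero    (x ∷ xs) _ = inj₂ singleton
  coloured-tree (suc a) (suc b) (y ∷ rest) (s≤s len)
    with ≤-split (2 * treeRamsey a (suc b)) (2 * treeRamsey (suc a) b)
                 (length (class (c y) false rest)) (length (class (c y) true rest))
                 (subst (_ ≤_) (sym (length-classes (c y) rest)) len)
  ... | inj₁ F-large = grow false
          (λ P P⊆ len → Sum.map₂ (weaken P⊆) (coloured-tree a (suc b) P len)) F-large
  ... | inj₂ T-large = Sum.swap (grow true
          (λ P P⊆ len → Sum.swap (Sum.map₁ (weaken P⊆) (coloured-tree (suc a) b P len))) T-large)

module EndHomogeneity {n : ℕ} (χ : Fin n → Fin n → Fin n → Bool) where

  HomogeneousAfter : Fin n → List (Fin n) → Set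
  HomogeneousAfter q L = ∀ {y z w} → y ∈ L → z ∈ L → w ∈ L →
                         y Fin.< z → y Fin.< w → χ q y z ≡ χ q y w

  EndHomogeneous : List (Fin n) → Set
  EndHomogeneous L = ∀ {x y z w} → x ∈ L → y ∈ L → z ∈ L → w ∈ L →
                     x Fin.< y → y Fin.< z → y Fin.< w → χ x y z ≡ χ x y w

  Determined : (Fin n → Fin n → Bool) → List (Fin n) → Set
  Determined c L = ∀ {x y z} → x ∈ L → y ∈ L → z ∈ L →
                   x Fin.< y → y Fin.< z → χ x y z ≡ c x y

  homogeneousAfter-∷ : ∀ {q x B} → Monochromatic (χ q x) B → All (x Fin.<_) B →
                       HomogeneousAfter q B → HomogeneousAfter q (x ∷ B)
  homogeneousAfter-∷ (_ , mono) x<B hom (here refl) z∈ w∈ x<z x<w =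
    trans (All.lookup mono (∈-tail z∈ x<z)) (sym (All.lookup mono (∈-tail w∈ x<w)))
  homogeneousAfter-∷ (_ , mono) x<B hom (there y∈) z∈ w∈ y<z y<w =
    hom y∈ (∈-tail z∈ (<-trans x<y y<z)) (∈-tail w∈ (<-trans x<y y<w)) y<z y<w
    where x<y = All.lookup x<B y∈

  endHomogeneous-∷ : ∀ {x B} → All (x Fin.<_) B → HomogeneousAfter x B → EndHomogeneous B →
                     EndHomogeneous (x ∷ B)
  endHomogeneous-∷ x<B homˣ hom (here refl) y∈ z∈ w∈ x<y y<z y<w =
    homˣ (∈-tail y∈ x<y) (∈-tail z∈ (<-trans x<y y<z)) (∈-tail w∈ (<-trans x<y y<w)) y<z y<w
  endHomogeneous-∷ x<B homˣ hom (there x′∈) y∈ z∈ w∈ x′<y y<z y<w =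
    hom x′∈ (∈-tail y∈ x<y) (∈-tail z∈ (<-trans x<y y<z)) (∈-tail w∈ (<-trans x<y y<w))
        x′<y y<z y<w
    where x<y = <-trans (All.lookup x<B x′∈) x′<y

  endHomogeneous-sublist : ∀ t (Q S : List (Fin n)) →
    AllPairs Fin._<_ S → endHomSize (length Q) t ≤ length S →
    ∃[ B ] B ⊆ S × t ≤ length B × All (λ q → HomogeneousAfter q B) Q × EndHomogeneous B
  endHomogeneous-sublist zero    Q S        _ _ =
    [] , minimum S , z≤n , All.universal (λ _ ()) Q , λ ()
  endHomogeneous-sublist (suc t) Q (x ∷ rest) (x<rest ∷ sorted) (s≤s len)
    with monochromatic-sublist (λ q → χ q x) Q rest
  ... | P , P⊆rest , monoᴾ , |rest|≤
    with endHomogeneous-sublist t (x ∷ Q) P (AllPairs-⊆ P⊆rest sorted)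
           (*-cancelˡ-≤ (2 ^ length Q) {{m^n≢0 2 (length Q)}} (≤-trans len |rest|≤))
  ...   | B , B⊆P , |B| , homˣ ∷ homᴽ , hom =
    x ∷ B , refl ∷ ⊆-trans B⊆P P⊆rest , s≤s |B| ,
    All.zipWith extend (monoᴾ , homᴽ) , endHomogeneous-∷ x<B homˣ hom
    where
      x<B = All-resp-⊆ (⊆-trans B⊆P P⊆rest) x<rest
      extend : ∀ {q} → Monochromatic (χ q x) P × HomogeneousAfter q B → HomogeneousAfter q (x ∷ B)
      extend (mono , homq) = homogeneousAfter-∷ (monochromatic-⊆ B⊆P mono) x<B homq

  -- χ x y · is constant above y, so it can be read off at the largest element of L.
  endHomogeneous⇒determined : ∀ L → EndHomogeneous L → ∃[ c ] Determined c L
  endHomogeneous⇒determined []       _   = (λ _ _ → true) , λ ()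
  endHomogeneous⇒determined (x ∷ xs) hom =
    (λ u v → χ u v ℓ) ,
    λ x∈ y∈ z∈ x<y y<z → hom x∈ y∈ z∈ ℓ∈ x<y y<z (<-≤-trans y<z (≤ℓ z∈))
    where
      ℓ = argmax toℕ x xs
      ℓ∈ : ℓ ∈ x ∷ xs
      ℓ∈ = [ here , there ]′ (argmax-sel toℕ x xs)
      ≤ℓ : ∀ {z} → z ∈ x ∷ xs → z Fin.≤ ℓ
      ≤ℓ (here refl) = f[⊥]≤f[argmax] {f = toℕ} x xs
      ≤ℓ (there z∈)  = All.lookup (f[xs]≤f[argmax] {f = toℕ} x xs) z∈

module _ {n : ℕ} (o : EdgeOrdering n) where

  increasingᵇ : Fin n → Fin n → Fin n → Bool
  increasingᵇ x y z = rank o y z <ᵇ rank o x y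

  increasingᵇ-true : ∀ {x y z} → increasingᵇ x y z ≡ true → rank o y z < rank o x y
  increasingᵇ-true {x} {y} {z} eq = <ᵇ⇒< (rank o y z) (rank o x y) (subst T (sym eq) tt)

  increasingᵇ-false : ∀ {x y z} → x Fin.< y → y Fin.< z → increasingᵇ x y z ≡ false →
                      rank o x y < rank o y z
  increasingᵇ-false {x} {y} {z} x<y y<z eq = ≤∧≢⇒< (≮⇒≥ (λ lt → subst T eq (<⇒<ᵇ lt))) distinct
    where
      distinct : rank o x y ≢ rank o y z
      distinct eq′ with injective o x y y z (Finₚ.<⇒≢ x<y) (Finₚ.<⇒≢ y<z) eq′
      ... | inj₁ (x≡y , _) = Finₚ.<⇒≢ x<y x≡y
      ... | inj₂ (x≡z , _) = Finₚ.<⇒≢ (<-trans x<y y<z) x≡z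

  linked⇒increasing : ∀ {E : Fin n → Fin n → Set} →
                      (∀ {x y z} → E x y → E y z → rank o y z < rank o x y) →
                      ∀ {p} → Linked E p → IncreasingPath o p
  linked⇒increasing step []                = tt
  linked⇒increasing step [-]               = tt
  linked⇒increasing step (_ ∷ [-])         = tt
  linked⇒increasing step (e ∷ e′ ∷ linked) = step e e′ , linked⇒increasing step (e′ ∷ linked)

  linked⇒decreasing : ∀ {E : Fin n → Fin n → Set} →
                      (∀ {x y z} → E x y → E y z → rank o x y < rank o y z) →
                      ∀ {p} → Linked E p → DecreasingPath o p
  linked⇒decreasing step []                = tt
  linked⇒decreasing step [-]               = tt
  linked⇒decreasing step (_ ∷ [-])         = tt
  linked⇒decreasing step (e ∷ e′ ∷ linked) = step e e′ , linked⇒decreasing step (e′ ∷ linked)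

  open EndHomogeneity increasingᵇ

  coloured⇒monotone : ∀ {c L b d} (t : BTree n d) → AllPairs Fin._<_ L → Determined c L →
                      vertices t ⊆ L → TreeRamsey.Coloured c b t → Monotone o t
  coloured⇒monotone {L = L} {b} t sortedᴸ det t⊆L col = monotone b step
    where
      sorted = AllPairs-⊆ t⊆L sortedᴸ
      inL : ∀ {x} → x ∈ vertices t → x ∈ L
      inL = Any-resp-⊆ t⊆L
      Step : Bool → Set
      Step b = ∀ {x y z} → EdgeOf t x y → EdgeOf t y z →
               x Fin.< y × y Fin.< z × increasingᵇ x y z ≡ b
      step : Step b
      step xy yz = x<y , y<z ,
        trans (det (inL (proj₁ (edge-endpoints t xy))) (inL (proj₂ (edge-endpoints t xy)))
                   (inL (proj₂ (edge-endpoints t yz))) x<y y<z)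
              (All.lookup col xy)
        where x<y = sorted⇒edge-< t sorted xy
              y<z = sorted⇒edge-< t sorted yz
      monotone : ∀ b → Step b → Monotone o t
      monotone true  steps = inj₁ (All.map (linked⇒increasing (λ xy yz →
        increasingᵇ-true (proj₂ (proj₂ (steps xy yz))))) (paths-linked t))
      monotone false steps = inj₂ (All.map (linked⇒decreasing (λ xy yz →
        let x<y , y<z , eq = steps xy yz in increasingᵇ-false x<y y<z eq)) (paths-linked t))

  nc-monotone-tree : ∀ d → threshold d ≤ n → ∃[ s ] HasNCMonotoneTree o s × suc d ≤ s
  nc-monotone-tree d T≤n
    with endHomogeneous-sublist (treeRamsey d d) [] (allFin n) (allFin-sorted n)
           (subst (threshold d ≤_) (sym (length-allFin n)) T≤n)
  ... | B , B⊆ , |B| , _ , hom with endHomogeneous⇒determined B hom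
  ...   | c , det = [ tree , tree ]′ (TreeRamsey.coloured-tree c d d B |B|)
    where
      sortedᴮ = AllPairs-⊆ B⊆ (allFin-sorted n)
      tree : ∀ {b} → TreeRamsey.ColouredTree c b d B → ∃[ s ] HasNCMonotoneTree o s × suc d ≤ s
      tree (t , t⊆B , col) =
        size t , (d , t , sorted⇒subtree t sorted , sorted⇒nonCrossing t sorted ,
                  coloured⇒monotone t sortedᴮ det t⊆B col , refl) , 1+depth≤size t
        where sorted = AllPairs-⊆ t⊆B sortedᴮ

theorem3 : Σ ℕ λ k → 1 ≤ k × (Σ ℕ λ N → (n : ℕ) → N ≤ n → (o : EdgeOrdering n) →
             Σ ℕ λ s → HasNCMonotoneTree o s × n ≤ 2 ^ (2 ^ (k * s)))
theorem3 = 12 , s≤s z≤n , 1 , λ n 1≤n o →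
  let d , T≤n , n≤Ud = bracket threshold U (λ d → threshold-≤ (suc d)) n 1≤n (n≤U n)
      s , tree , d<s = nc-monotone-tree o d T≤n
  in s , tree , ≤-trans n≤Ud (^-monoʳ-≤ 2 (^-monoʳ-≤ 2 (*-monoʳ-≤ 12 d<s)))
  where
    U : ℕ → ℕ
    U d = 2 ^ (2 ^ (12 * suc d))
    n≤U : ∀ n → n ≤ U n
    n≤U n = ≤-trans (n≤2^n n) (^-monoʳ-≤ 2 (≤-trans (n≤2^n n)
              (^-monoʳ-≤ 2 (≤-trans (n≤1+n n) (m≤n*m (suc n) 12)))))
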